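{- For every $k\in\mathbb N$, \[\sum_{\ell\in[N]}\sum_{i\in[k]}\sum_{V\in\mathcal C_i(\ell)}\kappa^{(k)}_V([\ell-1])=\sum_{i\in[k]}(-1)^{i+1}\kappa_i.\]
   Context: $\Gamma=(\Omega,\mathcal X)$ is a hypergraph on a finite set $\Omega$, $\mathbf p\in(0,1)^\Omega$, $\Omega_{\mathbf p}$ the random subset containing each $\omega$ independently with probability $p_\omega$. Edges are ordered $\gamma_1,\dots,\gamma_N$; $X_i$ is the indicator of $\gamma_i\subseteq\Omega_{\mathbf p}$; $X_V=\prod_{i\in V}X_i$. The dependency graph $G_\Gamma$ on $[N]$ joins $i\ne j$ iff $\gamma_i\cap\gamma_j\ne\emptyset$. $\mathcal C_i$ = family of $i$-element $V\subseteq[N]$ with $G_\Gamma[V]$ connected; $\mathcal C_i(\ell)=\{V\in\mathcal C_i:\max V=\ell\}$. For a set $\pi$ of subsets of $[N]$, $\mu_\pi=\prod_{P\in\pi}\mathbb E[X_P]$. For nonempty $V$, $\kappa(V)=\sum_{\pi}(-1)^{|\pi|-1}(|\pi|-1)!\mu_\pi$ over all partitions $\pi$ of $V$ into nonempty parts, and $\kappa_i=\sum_{V\in\mathcal C_i}\kappa(V)$. $U\to V$ ($U$ attaches to $V$) means every connected component of $G_\Gamma[U\cup V]$ contains a vertex of $V$. For $\emptyset\ne V\subseteq W\subseteq[N]$, $\Pi^{\mathsf C}_V(W)$ is the set of partitions $\pi$ of $W$ having a part $P\supseteq V$ such that $V$ is a union of connected components of $G_\Gamma[P]$, and $\kappa_V(W)=\sum_{\pi\in\Pi^{\mathsf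 C}_V(W)}(-1)^{|\pi|-1}(|\pi|-1)!\mu_\pi$. For nonempty $V$ and $S\subseteq[N]$, $\kappa^{(k)}_V(S)=\sum(-1)^{|W|-1}\kappa_V(W)$ over $W$ with $V\subseteq W\subseteq V\cup S$, $W\to V$, $|W|\le k$. -}

module Defs where

-- Setting of Lemma 3.5.
--   Ω = Fin m (ground set), [N] = Fin N (edge indices, with the usual order
--   of Fin N standing for 1 < 2 < ... < N), γ : Fin N → Subset m the
--   ordered edges γ₁,…,γ_N.
--   All predicates are Bool-valued so that the finite sums can be computed.

open import Level using (Level)
open import Data.Bool using (Bool; true; false; _∧_; _∨_; not; if_then_else_)
open import Data.Nat using (ℕ; zero; suc; _∸_; _≤ᵇ_; _≡ᵇ_; _<ᵇ_)
open import Data.Fin using (Fin; toℕ)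
open import Data.Fin.Subset using (Subset; ⁅_⁆; _∪_; ∣_∣; inside; outside)
open import Data.Vec using (Vec; []; _∷_; lookup)
open import Data.List using (List; []; _∷_; [_]; map; concatMap; allFin; filterᵇ; foldr; length; upTo)
open import Data.Bool.ListAction using (all; any)
open import Algebra.Bundles using (CommutativeRing)
open import Relation.Nullary.Decidable using (⌊_⌋)
import Data.Fin.Properties as FinP

subsets : ∀ n → List (Subset n)
subsets zero    = [ [] ]
subsets (suc n) = concatMap (λ s → (outside ∷ s) ∷ (inside ∷ s) ∷ []) (subsets n)

module _ {n : ℕ} where

  _∈ᵇ_ : Fin n → Subset n → Bool
  i ∈ᵇ A = lookup A i

  elems : Subset n → List (Fin n)
  elems A = filterᵇ (_∈ᵇ A) (allFin n)

  _⊆ᵇ_ : Subset n → Subset n → Bool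
  A ⊆ᵇ B = all (λ i → not (i ∈ᵇ A) ∨ (i ∈ᵇ B)) (allFin n)

  _≐ᵇ_ : Subset n → Subset n → Bool
  A ≐ᵇ B = (A ⊆ᵇ B) ∧ (B ⊆ᵇ A)

  meets : Subset n → Subset n → Bool
  meets A B = any (λ i → (i ∈ᵇ A) ∧ (i ∈ᵇ B)) (allFin n)

  nonemptyᵇ : Subset n → Bool
  nonemptyᵇ A = any (_∈ᵇ A) (allFin n)

  -- [ℓ-1] : the indices strictly below ℓ
  below : Fin n → Subset n
  below ℓ = Data.Vec.tabulate (λ j → toℕ j <ᵇ toℕ ℓ)

  hasMax : Subset n → Fin n → Bool
  hasMax V ℓ = (ℓ ∈ᵇ V) ∧ all (λ j → not (j ∈ᵇ V) ∨ (toℕ j ≤ᵇ toℕ ℓ)) (allFin n)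

  -- Set partitions of a list of (distinct) elements into nonempty blocks;
  -- every partition of the underlying set occurs exactly once.
  insertEach : Fin n → List (Subset n) → List (List (Subset n))
  insertEach x []      = []
  insertEach x (B ∷ π) = ((⁅ x ⁆ ∪ B) ∷ π) ∷ map (B ∷_) (insertEach x π)

  partitionsL : List (Fin n) → List (List (Subset n))
  partitionsL []       = [ [] ]
  partitionsL (x ∷ xs) = concatMap (λ π → (⁅ x ⁆ ∷ π) ∷ insertEach x π) (partitionsL xs)

  partitions : Subset n → List (List (Subset n))
  partitions W = partitionsL (elems W)

module Graph {m N : ℕ} (γ : Fin N → Subset m) where

  adj : Fin N → Fin N → Bool
  adj i j = not ⌊ i FinP.≟ j ⌋ ∧ meets (γ i) (γ j)

  step : Subset N → Subset N → Subset N
  step W S = Data.Vec.tabulate (λ u → (u ∈ᵇ S) ∨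
               ((u ∈ᵇ W) ∧ any (λ w → (w ∈ᵇ S) ∧ adj u w) (allFin N)))

  iter : ℕ → (Subset N → Subset N) → Subset N → Subset N
  iter zero    f x = x
  iter (suc t) f x = f (iter t f x)

  -- vertex set of the connected component of G_Γ[W] containing u (for u ∈ W);
  -- N growth steps suffice since there are only N vertices
  comp : Subset N → Fin N → Subset N
  comp W u = iter N (step W) ⁅ u ⁆

  connected : Subset N → Bool
  connected W = nonemptyᵇ W ∧ all (λ u → not (u ∈ᵇ W) ∨ (comp W u ≐ᵇ W)) (allFin N)

  unionOfComponents : Subset N → Subset N → Bool
  unionOfComponents V P = (V ⊆ᵇ P) ∧ all (λ u → not (u ∈ᵇ V) ∨ (comp P u ⊆ᵇ V)) (allFin N)

  attaches : Subset N → Subset N → Bool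
  attaches U V = all (λ u → not (u ∈ᵇ (U ∪ V)) ∨ meets (comp (U ∪ V) u) V) (allFin N)

  goodPartition : Subset N → List (Subset N) → Bool
  goodPartition V π = any (λ P → (V ⊆ᵇ P) ∧ unionOfComponents V P) π

  Cℓ : ℕ → Fin N → List (Subset N)
  Cℓ i ℓ = filterᵇ (λ V → (∣ V ∣ ≡ᵇ i) ∧ connected V ∧ hasMax V ℓ) (subsets N)

  C : ℕ → List (Subset N)
  C i = filterᵇ (λ V → (∣ V ∣ ≡ᵇ i) ∧ connected V) (subsets N)

-- Moments and (partial) cumulants, with values in a commutative ring R.
-- E[X_P] = ∏_{ω ∈ ⋃_{i∈P} γᵢ} p_ω  (independence of the coordinates).

module Cumulants {c ℓ' : Level} (R : CommutativeRing c ℓ')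
                 {m N : ℕ} (γ : Fin N → Subset m) (p : Fin m → CommutativeRing.Carrier R) where

  open CommutativeRing R
  open Graph γ

  Σ : {A : Set} → List A → (A → Carrier) → Carrier
  Σ xs f = foldr (λ x acc → f x + acc) 0# xs

  Π : {A : Set} → List A → (A → Carrier) → Carrier
  Π xs f = foldr (λ x acc → f x * acc) 1# xs

  sgn : ℕ → Carrier
  sgn zero    = 1#
  sgn (suc n) = - sgn n

  nat : ℕ → Carrier
  nat zero    = 0#
  nat (suc n) = 1# + nat n

  fact : ℕ → Carrier
  fact zero    = 1#
  fact (suc n) = nat (suc n) * fact n

  cover : Subset N → Subset m
  cover P = foldr (λ i acc → γ i ∪ acc) (Data.Vec.replicate m outside) (elems P)

  -- E[X_P] = P(⋃_{i∈P} γᵢ ⊆ Ω_p)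
  EX : Subset N → Carrier
  EX P = Π (allFin m) (λ ω → if ω ∈ᵇ cover P then p ω else 1#)

  μ : List (Subset N) → Carrier
  μ π = Π π EX

  coef : List (Subset N) → Carrier
  coef π = sgn (length π ∸ 1) * fact (length π ∸ 1)

  κ : Subset N → Carrier
  κ V = Σ (partitions V) (λ π → coef π * μ π)

  κᵢ : ℕ → Carrier
  κᵢ i = Σ (C i) κ

  κ[_]_ : Subset N → Subset N → Carrier
  κ[ V ] W = Σ (filterᵇ (goodPartition V) (partitions W)) (λ π → coef π * μ π)

  κ⁽_⁾[_] : ℕ → Subset N → Subset N → Carrier
  κ⁽ k ⁾[ V ] S = Σ (filterᵇ (λ W → (V ⊆ᵇ W) ∧ (W ⊆ᵇ (V ∪ S)) ∧ attaches W V ∧ (∣ W ∣ ≤ᵇ k))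
                             (subsets N))
                    (λ W → sgn (∣ W ∣ ∸ 1) * κ[ V ] W)

  range : ℕ → List ℕ
  range k = map suc (upTo k)

  LHS : ℕ → Carrier
  LHS k = Σ (allFin N) (λ ℓ → Σ (range k) (λ i → Σ (Cℓ i ℓ) (λ V → κ⁽ k ⁾[ V ] (below ℓ))))

  RHS : ℕ → Carrier
  RHS k = Σ (range k) (λ i → sgn (suc i) * κᵢ i)

-- Exchanging the order of summation turns both sides into sums over W ⊆ [N]. On the right, W
-- contributes (-1)^{|W|+1} κ(W) if G_Γ[W] is connected and |W| ≤ k, and nothing otherwise.
-- On the left, ℓ ∈ V ⊆ W ⊆ V ∪ [ℓ-1] forces ℓ = max W. Expanding each κ_V(W) over the
-- partitions π of W, a given π can only be counted for one V, namely the component of max W in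
-- the block of π containing max W, and it is counted exactly when W → V, i.e. when G_Γ[W] is
-- connected. So W also contributes (-1)^{|W|-1} κ(W) on the left, under the same conditions.
module Submission where

open import Defs
open import Level using (Level)
open import Algebra.Bundles using (CommutativeRing)
open import Function.Base using (_∘_; id; const)
open import Function.Bundles using (Equivalence; _⇔_; mk⇔)
open import Function.Definitions using (Injective)
open import Data.Bool using (Bool; true; false; _∧_; _∨_; not; if_then_else_; T)
open import Data.Bool.ListAction using (all; any)
open import Data.Bool.Properties using (T-≡; T-∧; T-∨)
open import Data.Empty using (⊥; ⊥-elim)
open import Data.Product using (∃; _×_; _,_; proj₁; proj₂; uncurry)
open import Data.Sum using (_⊎_; inj₁; inj₂; [_,_])
open import Data.Nat using (ℕ; zero; suc; _≤_; _<_; z≤n; s≤s; _≤ᵇ_; _≡ᵇ_; _∸_)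
open import Data.Nat.Properties as ℕ using (≤-trans; <⇒≤; <ᵇ⇒<; <⇒<ᵇ; ≤ᵇ⇒≤; ≤⇒≤ᵇ; ≡ᵇ⇒≡; ≡⇒≡ᵇ)
open import Data.Fin using (Fin; toℕ)
import Data.Fin as Fin
import Data.Fin.Properties as Fin
open import Data.Fin.Properties using (¬∀⟶∃¬; ≤-totalOrder)
open import Data.Fin.Subset using (Subset; ⁅_⁆; _∪_; _∩_; ∣_∣; inside; outside; _∈_; _∉_; _⊆_; _⊂_; Nonempty)
open import Data.Fin.Subset.Properties
  using ( _∈?_; _⊆?_; ∩-comm; p⊆p∪q; ∣⁅x⁆∣≡1; x∈⁅x⁆; x∈⁅y⁆⇒x≡y; x∈p∪q⁺; x∈p∪q⁻; x∈p∩q⁺; x∈p∩q⁻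
        ; ⊆-refl; ⊆-antisym; p⊆q⇒∣p∣≤∣q∣; p⊂q⇒∣p∣<∣q∣; ∣p∣≤n)
open import Data.Vec using ([]; _∷_; lookup; tabulate)
open import Data.Vec.Properties using (≡-dec; ∷-injectiveʳ; lookup∘tabulate; lookup⇒[]=; []=⇒lookup)
open import Data.List using (List; []; _∷_; _++_; allFin; foldr; filterᵇ; concatMap; map; upTo)
open import Data.List.Membership.Propositional using (find; lose) renaming (_∈_ to _∈ᴸ_)
open import Data.List.Membership.Propositional.Properties
  using (∈-allFin; ∈-map⁺; ∈-map⁻; ∈-upTo⁺; ∈-upTo⁻; ∈-concatMap⁻; ∈-filter⁺; ∈-filter⁻)
open import Data.List.Relation.Unary.All using (All; []; _∷_)
import Data.List.Relation.Unary.All as All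
open import Data.List.Relation.Unary.All.Properties using (all⁺; all⁻)
open import Data.List.Relation.Unary.Any using (Any; here; there)
open import Data.List.Relation.Unary.Any.Properties using (any⁺; any⁻)
open import Data.List.Relation.Unary.AllPairs using (AllPairs; []; _∷_)
open import Data.List.Relation.Unary.Unique.Propositional using (Unique)
import Data.List.Relation.Unary.Unique.Propositional.Properties as Unique
open import Relation.Nullary using (¬_; Dec; yes; no; contradiction)
open import Relation.Nullary.Decidable using (T?; _→-dec_; _×-dec_; toWitnessFalse; fromWitnessFalse)
open import Relation.Binary.PropositionalEquality using (_≡_; _≢_; refl; sym; trans; cong; subst)

private
  variable
    n : ℕ
    A B : Subset n
    i : Fin n

∧⁺ : ∀ {a b} → T a → T b → T (a ∧ b)
∧⁺ ta tb = Equivalence.from T-∧ (ta , tb)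

∧⁻ : ∀ {a b} → T (a ∧ b) → T a × T b
∧⁻ = Equivalence.to T-∧

allFin⁺ : ∀ (p : Fin n → Bool) → (∀ i → T (p i)) → T (all p (allFin n))
allFin⁺ p h = all⁻ p {allFin _} (All.tabulate λ {i} _ → h i)

allFin⁻ : ∀ (p : Fin n → Bool) → T (all p (allFin n)) → ∀ i → T (p i)
allFin⁻ p t i = All.lookup (all⁺ p _ t) (∈-allFin i)

allFin-⇒⁺ : ∀ (p q : Fin n → Bool) → (∀ i → T (p i) → T (q i)) →
            T (all (λ i → not (p i) ∨ q i) (allFin n))
allFin-⇒⁺ p q h = allFin⁺ (λ i → not (p i) ∨ q i) λ i → ⇒ᵇ⁺ (h i)
  where
  ⇒ᵇ⁺ : ∀ {a b} → (T a → T b) → T (not a ∨ b)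
  ⇒ᵇ⁺ {true}  f = f _
  ⇒ᵇ⁺ {false} f = _

allFin-⇒⁻ : ∀ (p q : Fin n → Bool) → T (all (λ i → not (p i) ∨ q i) (allFin n)) →
            ∀ i → T (p i) → T (q i)
allFin-⇒⁻ p q t i = ⇒ᵇ⁻ (allFin⁻ (λ i → not (p i) ∨ q i) t i)
  where
  ⇒ᵇ⁻ : ∀ {a b} → T (not a ∨ b) → T a → T b
  ⇒ᵇ⁻ {true} tb _ = tb

anyFin⁺ : ∀ (p : Fin n → Bool) i → T (p i) → T (any p (allFin n))
anyFin⁺ p i t = any⁺ p (lose (∈-allFin i) t)

anyFin⁻ : ∀ (p : Fin n → Bool) → T (any p (allFin n)) → ∃ λ i → T (p i)
anyFin⁻ p t with i , _ , ti ← find (any⁻ p (allFin _) t) = i , ti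

∈ᵇ⁺ : i ∈ A → T (i ∈ᵇ A)
∈ᵇ⁺ i∈A rewrite []=⇒lookup i∈A = _

∈ᵇ⁻ : T (i ∈ᵇ A) → i ∈ A
∈ᵇ⁻ {i = i} {A = A} t = lookup⇒[]= i A (Equivalence.to T-≡ t)

⊆ᵇ⁺ : A ⊆ B → T (A ⊆ᵇ B)
⊆ᵇ⁺ {A = A} {B = B} A⊆B = allFin-⇒⁺ (_∈ᵇ A) (_∈ᵇ B) λ _ → ∈ᵇ⁺ ∘ A⊆B ∘ ∈ᵇ⁻

⊆ᵇ⁻ : T (A ⊆ᵇ B) → A ⊆ B
⊆ᵇ⁻ {A = A} {B = B} t = ∈ᵇ⁻ ∘ allFin-⇒⁻ (_∈ᵇ A) (_∈ᵇ B) t _ ∘ ∈ᵇ⁺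

≐ᵇ⁺ : A ≡ B → T (A ≐ᵇ B)
≐ᵇ⁺ {A = A} refl = ∧⁺ (⊆ᵇ⁺ {A = A} ⊆-refl) (⊆ᵇ⁺ {A = A} ⊆-refl)

≐ᵇ⁻ : T (A ≐ᵇ B) → A ≡ B
≐ᵇ⁻ t = ⊆-antisym (⊆ᵇ⁻ (proj₁ (∧⁻ t))) (⊆ᵇ⁻ (proj₂ (∧⁻ t)))

meets⁺ : Nonempty (A ∩ B) → T (meets A B)
meets⁺ {A = A} {B = B} (i , i∈A∩B) with i∈A , i∈B ← x∈p∩q⁻ A B i∈A∩B =
  anyFin⁺ (λ i → (i ∈ᵇ A) ∧ (i ∈ᵇ B)) i (∧⁺ (∈ᵇ⁺ i∈A) (∈ᵇ⁺ i∈B))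

meets⁻ : T (meets A B) → Nonempty (A ∩ B)
meets⁻ {A = A} {B = B} t with i , ti ← anyFin⁻ (λ i → (i ∈ᵇ A) ∧ (i ∈ᵇ B)) t =
  i , x∈p∩q⁺ (∈ᵇ⁻ (proj₁ (∧⁻ ti)) , ∈ᵇ⁻ (proj₂ (∧⁻ ti)))

nonemptyᵇ⁺ : Nonempty A → T (nonemptyᵇ A)
nonemptyᵇ⁺ {A = A} (i , i∈A) = anyFin⁺ (_∈ᵇ A) i (∈ᵇ⁺ i∈A)

nonemptyᵇ⁻ : T (nonemptyᵇ A) → Nonempty A
nonemptyᵇ⁻ {A = A} t with i , ti ← anyFin⁻ (_∈ᵇ A) t = i , ∈ᵇ⁻ ti

tabulate⁺ : ∀ {f : Fin n → Bool} → T (f i) → i ∈ tabulate f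
tabulate⁺ {i = i} {f = f} t = ∈ᵇ⁻ (subst T (sym (lookup∘tabulate f i)) t)

tabulate⁻ : ∀ {f : Fin n → Bool} → i ∈ tabulate f → T (f i)
tabulate⁻ {i = i} {f = f} i∈ = subst T (lookup∘tabulate f i) (∈ᵇ⁺ i∈)

below⁺ : ∀ {ℓ} → i Fin.< ℓ → i ∈ below ℓ
below⁺ = tabulate⁺ ∘ <⇒<ᵇ

below⁻ : ∀ {ℓ} → i ∈ below ℓ → i Fin.< ℓ
below⁻ = <ᵇ⇒< _ _ ∘ tabulate⁻

elems⁺ : i ∈ A → i ∈ᴸ elems A
elems⁺ {i = i} {A = A} i∈A = ∈-filter⁺ (λ j → T? (j ∈ᵇ A)) (∈-allFin i) (∈ᵇ⁺ i∈A)

elems⁻ : i ∈ᴸ elems A → i ∈ A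
elems⁻ {A = A} i∈ = ∈ᵇ⁻ (proj₂ (∈-filter⁻ (λ j → T? (j ∈ᵇ A)) {xs = allFin _} i∈))

elems-unique : Unique (elems A)
elems-unique {A = A} = Unique.filter⁺ (λ i → T? (i ∈ᵇ A)) (Unique.allFin⁺ _)

IsMax : Subset n → Fin n → Set
IsMax V ℓ = ℓ ∈ V × (∀ {j} → j ∈ V → j Fin.≤ ℓ)

hasMax⁺ : ∀ {V ℓ} → IsMax {n} V ℓ → T (hasMax V ℓ)
hasMax⁺ {V = V} {ℓ} (ℓ∈V , ≤ℓ) =
  ∧⁺ (∈ᵇ⁺ ℓ∈V) (allFin-⇒⁺ (_∈ᵇ V) (λ j → toℕ j ≤ᵇ toℕ ℓ) λ _ → ≤⇒≤ᵇ ∘ ≤ℓ ∘ ∈ᵇ⁻)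

hasMax⁻ : ∀ {V ℓ} → T (hasMax {n} V ℓ) → IsMax V ℓ
hasMax⁻ {V = V} {ℓ} t with ℓ∈V , t′ ← ∧⁻ {ℓ ∈ᵇ V} t =
  ∈ᵇ⁻ ℓ∈V , λ {j} → ≤ᵇ⇒≤ _ _ ∘ allFin-⇒⁻ (_∈ᵇ V) (λ j → toℕ j ≤ᵇ toℕ ℓ) t′ j ∘ ∈ᵇ⁺

module _ {n : ℕ} where

  open import Data.List.Extrema (≤-totalOrder n) using (max; argmax-sel; xs≤max)

  max-exists : {A : Subset n} → Nonempty A → ∃ (IsMax A)
  max-exists {A} (i , i∈A) = max i (elems A) , max∈A , All.lookup (xs≤max i (elems A)) ∘ elems⁺
    where
    max∈A : max i (elems A) ∈ A
    max∈A with argmax-sel id i (elems A)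
    ... | inj₁ max≡i = subst (_∈ A) (sym max≡i) i∈A
    ... | inj₂ max∈  = elems⁻ max∈

x∈p⇒0<∣p∣ : i ∈ A → 0 < ∣ A ∣
x∈p⇒0<∣p∣ {i = i} i∈A =
  ≤-trans (ℕ.≤-reflexive (sym (∣⁅x⁆∣≡1 i)))
          (p⊆q⇒∣p∣≤∣q∣ λ j∈ → subst (_∈ _) (sym (x∈⁅y⁆⇒x≡y i j∈)) i∈A)

⊆∧≢⇒⊂ : A ⊆ B → A ≢ B → A ⊂ B
⊆∧≢⇒⊂ {n} {A} {B} A⊆B A≢B with B ⊆? A
... | yes B⊆A = contradiction (⊆-antisym A⊆B B⊆A) A≢B
... | no  B⊈A = A⊆B , witness (¬∀⟶∃¬ n _ (λ i → i ∈? B →-dec i ∈? A) (λ h → B⊈A (h _)))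
  where
  witness : (∃ λ i → ¬ (i ∈ B → i ∈ A)) → ∃ λ i → i ∈ B × i ∉ A
  witness (i , i∈B↛i∈A) with i ∈? B
  ... | yes i∈B = i , i∈B , i∈B↛i∈A ∘ const
  ... | no  i∉B = ⊥-elim (i∈B↛i∈A (λ i∈B → contradiction i∈B i∉B))

_∈⋃_ : Fin n → List (Subset n) → Set
j ∈⋃ π = Any (j ∈_) π

Disjoint : Subset n → Subset n → Set
Disjoint P Q = ∀ {j} → j ∈ P → j ∈ Q → ⊥

private
  variable
    x j : Fin n
    P Q : Subset n
    π σ : List (Subset n)
    xs : List (Fin n)

disjoint-⋃⁺ : (∀ {j} → j ∈ P → ¬ j ∈⋃ π) → All (Disjoint P) π
disjoint-⋃⁺ h = All.tabulate λ Q∈π j∈P j∈Q → h j∈P (lose Q∈π j∈Q)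

disjoint-⋃⁻ : All (Disjoint P) π → j ∈ P → ¬ j ∈⋃ π
disjoint-⋃⁻ disj j∈P j∈⋃π with _ , Q∈π , j∈Q ← find j∈⋃π = All.lookup disj Q∈π j∈P j∈Q

disjoint-blocks-≡ : AllPairs Disjoint π → P ∈ᴸ π → Q ∈ᴸ π → j ∈ P → j ∈ Q → P ≡ Q
disjoint-blocks-≡ (_ ∷ _)      (here refl) (here refl) _   _   = refl
disjoint-blocks-≡ (P-disj ∷ _) (here refl) (there Q∈)  j∈P j∈Q = ⊥-elim (All.lookup P-disj Q∈ j∈P j∈Q)
disjoint-blocks-≡ (Q-disj ∷ _) (there P∈)  (here refl) j∈P j∈Q = ⊥-elim (All.lookup Q-disj P∈ j∈Q j∈P)
disjoint-blocks-≡ (_ ∷ disj)   (there P∈)  (there Q∈)  j∈P j∈Q = disjoint-blocks-≡ disj P∈ Q∈ j∈P j∈Q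

-- Every partition of x ∷ xs built by partitionsL arises from one of xs in one of these three ways.
data Adds (x : Fin n) : List (Subset n) → List (Subset n) → Set where
  new  : Adds x π (⁅ x ⁆ ∷ π)
  join : Adds x (P ∷ π) ((⁅ x ⁆ ∪ P) ∷ π)
  skip : Adds x π σ → Adds x (P ∷ π) (P ∷ σ)

insertEach-adds : σ ∈ᴸ insertEach x π → Adds x π σ
insertEach-adds {π = _ ∷ _} (here refl) = join
insertEach-adds {π = _ ∷ _} (there σ∈) with _ , σ′∈ , refl ← ∈-map⁻ (_ ∷_) σ∈ =
  skip (insertEach-adds σ′∈)

partitionsL-adds : π ∈ᴸ partitionsL (x ∷ xs) → ∃ λ π′ → π′ ∈ᴸ partitionsL xs × Adds x π′ π
partitionsL-adds {x = x} {xs = xs} π∈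
  with π′ , π′∈ , π∈′ ← find (∈-concatMap⁻ (λ π′ → (⁅ x ⁆ ∷ π′) ∷ insertEach x π′)
                                            {xs = partitionsL xs} π∈)
  with π∈′
... | here refl = π′ , π′∈ , new
... | there π∈″ = π′ , π′∈ , insertEach-adds π∈″

Adds-⋃⁻ : Adds x π σ → j ∈⋃ σ → j ≡ x ⊎ j ∈⋃ π
Adds-⋃⁻ {x = x} new           (here j∈⁅x⁆) = inj₁ (x∈⁅y⁆⇒x≡y x j∈⁅x⁆)
Adds-⋃⁻         new           (there j∈⋃)  = inj₂ j∈⋃
Adds-⋃⁻ {x = x} (join {P = P}) (here j∈)    = Data.Sum.map (x∈⁅y⁆⇒x≡y x) here (x∈p∪q⁻ ⁅ x ⁆ P j∈)
Adds-⋃⁻         join          (there j∈⋃)  = inj₂ (there j∈⋃)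
Adds-⋃⁻         (skip _)      (here j∈P)   = inj₂ (here j∈P)
Adds-⋃⁻         (skip adds)   (there j∈⋃)  = Data.Sum.map₂ there (Adds-⋃⁻ adds j∈⋃)

Adds-⋃⁺ : Adds x π σ → j ≡ x ⊎ j ∈⋃ π → j ∈⋃ σ
Adds-⋃⁺ {x = x} new         (inj₁ refl)         = here (x∈⁅x⁆ x)
Adds-⋃⁺         new         (inj₂ j∈⋃)          = there j∈⋃
Adds-⋃⁺ {x = x} join        (inj₁ refl)         = here (x∈p∪q⁺ (inj₁ (x∈⁅x⁆ x)))
Adds-⋃⁺         join        (inj₂ (here j∈P))   = here (x∈p∪q⁺ (inj₂ j∈P))
Adds-⋃⁺         join        (inj₂ (there j∈⋃))  = there j∈⋃
Adds-⋃⁺         (skip _)    (inj₂ (here j∈P))   = here j∈P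
Adds-⋃⁺         (skip adds) (inj₂ (there j∈⋃))  = there (Adds-⋃⁺ adds (inj₂ j∈⋃))
Adds-⋃⁺         (skip adds) (inj₁ j≡x)          = there (Adds-⋃⁺ adds (inj₁ j≡x))

Adds-disjoint : Adds x π σ → ¬ x ∈⋃ π → AllPairs Disjoint π → AllPairs Disjoint σ
Adds-disjoint {x = x} new x∉ disj =
  disjoint-⋃⁺ (λ j∈⁅x⁆ → subst (λ y → ¬ y ∈⋃ _) (sym (x∈⁅y⁆⇒x≡y x j∈⁅x⁆)) x∉) ∷ disj
Adds-disjoint {x = x} (join {P = P}) x∉ (P-disj ∷ disj) = disjoint-⋃⁺ joined-disj ∷ disj
  where
  joined-disj : ∀ {j} → j ∈ ⁅ x ⁆ ∪ P → ¬ j ∈⋃ _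
  joined-disj j∈ with x∈p∪q⁻ ⁅ x ⁆ P j∈
  ... | inj₁ j∈⁅x⁆ rewrite x∈⁅y⁆⇒x≡y x j∈⁅x⁆ = x∉ ∘ there
  ... | inj₂ j∈P   = disjoint-⋃⁻ P-disj j∈P
Adds-disjoint (skip {P = P} adds) x∉ (P-disj ∷ disj) =
  disjoint-⋃⁺ P-disj′ ∷ Adds-disjoint adds (x∉ ∘ there) disj
  where
  P-disj′ : ∀ {j} → j ∈ P → ¬ j ∈⋃ _
  P-disj′ j∈P j∈⋃ with Adds-⋃⁻ adds j∈⋃
  ... | inj₁ refl = x∉ (here j∈P)
  ... | inj₂ j∈⋃π = disjoint-⋃⁻ P-disj j∈P j∈⋃π

partitionsL-⋃⁻ : π ∈ᴸ partitionsL xs → j ∈⋃ π → j ∈ᴸ xs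
partitionsL-⋃⁻ {xs = []} (here refl) ()
partitionsL-⋃⁻ {xs = x ∷ xs} π∈ j∈⋃ with _ , π′∈ , adds ← partitionsL-adds {x = x} {xs = xs} π∈
  with Adds-⋃⁻ adds j∈⋃
... | inj₁ j≡x    = here j≡x
... | inj₂ j∈⋃π′ = there (partitionsL-⋃⁻ {xs = xs} π′∈ j∈⋃π′)

partitionsL-⋃⁺ : π ∈ᴸ partitionsL xs → j ∈ᴸ xs → j ∈⋃ π
partitionsL-⋃⁺ {xs = x ∷ xs} π∈ j∈xs with _ , π′∈ , adds ← partitionsL-adds {x = x} {xs = xs} π∈
  with j∈xs
... | here j≡x    = Adds-⋃⁺ adds (inj₁ j≡x)
... | there j∈xs′ = Adds-⋃⁺ adds (inj₂ (partitionsL-⋃⁺ {xs = xs} π′∈ j∈xs′))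

partitionsL-disjoint : Unique xs → π ∈ᴸ partitionsL xs → AllPairs Disjoint π
partitionsL-disjoint {xs = []} [] (here refl) = []
partitionsL-disjoint {xs = x ∷ xs} (x∉xs ∷ uniq) π∈
  with _ , π′∈ , adds ← partitionsL-adds {x = x} {xs = xs} π∈ =
  Adds-disjoint adds (λ x∈⋃ → All.lookup x∉xs (partitionsL-⋃⁻ {xs = xs} π′∈ x∈⋃) refl)
                     (partitionsL-disjoint {xs = xs} uniq π′∈)

module _ {W : Subset n} where

  partition-block : π ∈ᴸ partitions W → j ∈ W → ∃ λ P → P ∈ᴸ π × j ∈ P
  partition-block {π = π} π∈ j∈W = find (partitionsL-⋃⁺ {π = π} {xs = elems W} π∈ (elems⁺ j∈W))

  partition-⊆ : π ∈ᴸ partitions W → P ∈ᴸ π → P ⊆ W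
  partition-⊆ {π = π} π∈ P∈ j∈P = elems⁻ (partitionsL-⋃⁻ {π = π} {xs = elems W} π∈ (lose P∈ j∈P))

  partition-block-≡ : π ∈ᴸ partitions W → P ∈ᴸ π → Q ∈ᴸ π → j ∈ P → j ∈ Q → P ≡ Q
  partition-block-≡ {π = π} π∈ =
    disjoint-blocks-≡ (partitionsL-disjoint {xs = elems W} {π = π} (elems-unique {A = W}) π∈)

module Components {m N : ℕ} (γ : Fin N → Subset m) where

  open Graph γ hiding (C)

  adj⁻ : ∀ {u w} → T (adj u w) → u ≢ w × Nonempty (γ u ∩ γ w)
  adj⁻ t = Data.Product.map toWitnessFalse meets⁻ (∧⁻ t)

  adj⁺ : ∀ {u w} → u ≢ w → Nonempty (γ u ∩ γ w) → T (adj u w)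
  adj⁺ u≢w γu∩γw = ∧⁺ (fromWitnessFalse u≢w) (meets⁺ γu∩γw)

  adj-sym : ∀ {u w} → T (adj u w) → T (adj w u)
  adj-sym {u} {w} t with u≢w , γu∩γw ← adj⁻ t =
    adj⁺ (u≢w ∘ sym) (subst Nonempty (∩-comm (γ u) (γ w)) γu∩γw)

  Closed : Subset N → Subset N → Set
  Closed W C = ∀ {u w} → u ∈ W → w ∈ C → T (adj u w) → u ∈ C

  private
    variable
      u w a b : Fin N
      S C V W : Subset N

  step⁻ : u ∈ step W S → u ∈ S ⊎ (u ∈ W × ∃ λ w → w ∈ S × T (adj u w))
  step⁻ {u} {W} {S} u∈ with Equivalence.to T-∨ (tabulate⁻ u∈)
  ... | inj₁ u∈S = inj₁ (∈ᵇ⁻ u∈S)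
  ... | inj₂ t with u∈W , t′ ← ∧⁻ t with w , tw ← anyFin⁻ (λ w → (w ∈ᵇ S) ∧ adj u w) t′ =
    inj₂ (∈ᵇ⁻ u∈W , w , ∈ᵇ⁻ (proj₁ (∧⁻ {w ∈ᵇ S} tw)) , proj₂ (∧⁻ {w ∈ᵇ S} tw))

  step⁺ : u ∈ S ⊎ (u ∈ W × ∃ λ w → w ∈ S × T (adj u w)) → u ∈ step W S
  step⁺ {u} {S} {W} h = tabulate⁺ (Equivalence.from T-∨ (Data.Sum.map ∈ᵇ⁺ grow h))
    where
    grow : u ∈ W × (∃ λ w → w ∈ S × T (adj u w)) →
           T ((u ∈ᵇ W) ∧ any (λ w → (w ∈ᵇ S) ∧ adj u w) (allFin N))
    grow (u∈W , w , w∈S , u~w) =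
      ∧⁺ (∈ᵇ⁺ u∈W) (anyFin⁺ (λ w → (w ∈ᵇ S) ∧ adj u w) w (∧⁺ (∈ᵇ⁺ w∈S) u~w))

  step-inflationary : ∀ W → S ⊆ step W S
  step-inflationary W = step⁺ {W = W} ∘ inj₁

  step-⊆ : Closed W C → S ⊆ C → step W S ⊆ C
  step-⊆ W-closed S⊆C u∈ with step⁻ u∈
  ... | inj₁ u∈S                  = S⊆C u∈S
  ... | inj₂ (u∈W , w , w∈S , u~w) = W-closed u∈W (S⊆C w∈S) u~w

  reach : Subset N → Fin N → ℕ → Subset N
  reach W a t = iter t (step W) ⁅ a ⁆

  a∈reach : ∀ W a t → a ∈ reach W a t
  a∈reach W a zero    = x∈⁅x⁆ a
  a∈reach W a (suc t) = step-inflationary W (a∈reach W a t)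

  reach-⊆ : Closed W C → a ∈ C → ∀ t → reach W a t ⊆ C
  reach-⊆ W-closed a∈C zero    u∈ rewrite x∈⁅y⁆⇒x≡y _ u∈ = a∈C
  reach-⊆ W-closed a∈C (suc t) = step-⊆ W-closed (reach-⊆ W-closed a∈C t)

  reach-grows-or-stabilises : ∀ W a t → suc t ≤ ∣ reach W a t ∣ ⊎ step W (reach W a t) ≡ reach W a t
  reach-grows-or-stabilises W a zero = inj₁ (ℕ.≤-reflexive (sym (∣⁅x⁆∣≡1 a)))
  reach-grows-or-stabilises W a (suc t) with reach-grows-or-stabilises W a t
  ... | inj₂ stable = inj₂ (cong (step W) stable)
  ... | inj₁ grows with ≡-dec Data.Bool._≟_ (step W (reach W a t)) (reach W a t)
  ...   | yes stable = inj₂ (cong (step W) stable)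
  ...   | no  moved  =
    inj₁ (≤-trans (s≤s grows) (p⊂q⇒∣p∣<∣q∣ (⊆∧≢⇒⊂ (step-inflationary W) (moved ∘ sym))))

  step-comp : ∀ W a → step W (comp W a) ≡ comp W a
  step-comp W a with reach-grows-or-stabilises W a N
  ... | inj₂ stable = stable
  ... | inj₁ grows  = contradiction (≤-trans grows (∣p∣≤n (comp W a))) ℕ.1+n≰n

  a∈comp : ∀ W a → a ∈ comp W a
  a∈comp W a = a∈reach W a N

  comp-closed : ∀ W a → Closed W (comp W a)
  comp-closed W a u∈W w∈ u~w = subst (_ ∈_) (step-comp W a) (step⁺ (inj₂ (u∈W , _ , w∈ , u~w)))

  comp-least : Closed W C → a ∈ C → comp W a ⊆ C
  comp-least W-closed a∈C = reach-⊆ W-closed a∈C N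

  comp-⊆ : a ∈ W → comp W a ⊆ W
  comp-⊆ a∈W = comp-least (λ u∈W _ _ → u∈W) a∈W

  comp-mono : V ⊆ P → comp V a ⊆ comp P a
  comp-mono {V} {P} {a} V⊆P = comp-least (λ u∈V → comp-closed P a (V⊆P u∈V)) (a∈comp P a)

  -- The x ∈ W with a ∈ comp W x form a closed set containing a.
  comp-sym : a ∈ W → b ∈ comp W a → a ∈ comp W b
  comp-sym {a} {W} {b} a∈W b∈ =
    ∈ᵇ⁻ (proj₂ (∧⁻ {b ∈ᵇ W} (tabulate⁻ (comp-least closed a∈ b∈))))
    where
    closed : Closed W (tabulate λ x → (x ∈ᵇ W) ∧ (a ∈ᵇ comp W x))
    closed {u} {x} u∈W x∈ u~x with x∈W , a∈ ← ∧⁻ (tabulate⁻ x∈) =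
      tabulate⁺ (∧⁺ (∈ᵇ⁺ u∈W) (∈ᵇ⁺ (comp-least (comp-closed W u) x∈comp-u (∈ᵇ⁻ a∈))))
      where
      x∈comp-u : x ∈ comp W u
      x∈comp-u = comp-closed W u (∈ᵇ⁻ x∈W) (a∈comp W u) (adj-sym u~x)
    a∈ : a ∈ tabulate λ x → (x ∈ᵇ W) ∧ (a ∈ᵇ comp W x)
    a∈ = tabulate⁺ (∧⁺ (∈ᵇ⁺ a∈W) (∈ᵇ⁺ (a∈comp W a)))

  comp-≡ : a ∈ W → b ∈ comp W a → comp W b ≡ comp W a
  comp-≡ {a} {W} {b} a∈W b∈ =
    ⊆-antisym (comp-least (comp-closed W a) b∈) (comp-least (comp-closed W b) (comp-sym a∈W b∈))

  connected⁺ : Nonempty W → (∀ {u} → u ∈ W → comp W u ≡ W) → T (connected W)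
  connected⁺ {W} ne h =
    ∧⁺ (nonemptyᵇ⁺ ne) (allFin-⇒⁺ (_∈ᵇ W) (λ u → comp W u ≐ᵇ W) λ _ → ≐ᵇ⁺ ∘ h ∘ ∈ᵇ⁻)

  connected⁻ : T (connected W) → Nonempty W × (∀ {u} → u ∈ W → comp W u ≡ W)
  connected⁻ {W} t with ne , t′ ← ∧⁻ {nonemptyᵇ W} t =
    nonemptyᵇ⁻ ne , λ {u} → ≐ᵇ⁻ ∘ allFin-⇒⁻ (_∈ᵇ W) (λ u → comp W u ≐ᵇ W) t′ u ∘ ∈ᵇ⁺

  connected⇒0<∣W∣ : T (connected W) → 0 < ∣ W ∣
  connected⇒0<∣W∣ {W} = x∈p⇒0<∣p∣ ∘ proj₂ ∘ proj₁ ∘ connected⁻ {W}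

  ⊆comp⇒connected : a ∈ W → W ⊆ comp W a → T (connected W)
  ⊆comp⇒connected a∈W W⊆ = connected⁺ (_ , a∈W) λ u∈W →
    trans (comp-≡ a∈W (W⊆ u∈W)) (⊆-antisym (comp-⊆ a∈W) W⊆)

  unionOfComponents⁺ : V ⊆ P → (∀ {u} → u ∈ V → comp P u ⊆ V) → T (unionOfComponents V P)
  unionOfComponents⁺ {V} {P} V⊆P h =
    ∧⁺ (⊆ᵇ⁺ V⊆P) (allFin-⇒⁺ (_∈ᵇ V) (λ u → comp P u ⊆ᵇ V) λ _ → ⊆ᵇ⁺ ∘ h ∘ ∈ᵇ⁻)

  unionOfComponents⁻ : T (unionOfComponents V P) → V ⊆ P × (∀ {u} → u ∈ V → comp P u ⊆ V)
  unionOfComponents⁻ {V} {P} t with V⊆P , t′ ← ∧⁻ {V ⊆ᵇ P} t =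
    ⊆ᵇ⁻ V⊆P , λ {u} → ⊆ᵇ⁻ ∘ allFin-⇒⁻ (_∈ᵇ V) (λ u → comp P u ⊆ᵇ V) t′ u ∘ ∈ᵇ⁺

  attaches⁺ : (∀ {u} → u ∈ W ∪ V → Nonempty (comp (W ∪ V) u ∩ V)) → T (attaches W V)
  attaches⁺ {W} {V} h =
    allFin-⇒⁺ (_∈ᵇ (W ∪ V)) (λ u → meets (comp (W ∪ V) u) V) λ _ → meets⁺ ∘ h ∘ ∈ᵇ⁻

  attaches⁻ : T (attaches W V) → ∀ {u} → u ∈ W ∪ V → Nonempty (comp (W ∪ V) u ∩ V)
  attaches⁻ {W} {V} t {u} =
    meets⁻ ∘ allFin-⇒⁻ (_∈ᵇ (W ∪ V)) (λ u → meets (comp (W ∪ V) u) V) t u ∘ ∈ᵇ⁺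

  connected∧unionOfComponents⇒≡comp : T (connected V) → a ∈ V → T (unionOfComponents V P) → V ≡ comp P a
  connected∧unionOfComponents⇒≡comp {V} {a} {P} conn a∈V uoc
    with V⊆P , closed ← unionOfComponents⁻ {V} {P} uoc =
    ⊆-antisym (subst (_⊆ comp P a) (proj₂ (connected⁻ {V} conn) a∈V) (comp-mono V⊆P)) (closed a∈V)

  connected-comp : a ∈ P → T (connected (comp P a))
  connected-comp {a} {P} a∈P = ⊆comp⇒connected (a∈comp P a) (comp-least closed (a∈comp (comp P a) a))
    where
    closed : Closed P (comp (comp P a) a)
    closed u∈P w∈ u~w = comp-closed _ a (comp-closed P a u∈P (comp-⊆ (a∈comp P a) w∈) u~w) w∈ u~w

  unionOfComponents-comp : a ∈ P → T (unionOfComponents (comp P a) P)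
  unionOfComponents-comp {a} {P} a∈P = unionOfComponents⁺ (comp-⊆ a∈P) (comp-least (comp-closed P a))

  attaches⇔connected : T (connected V) → a ∈ V → V ⊆ W → T (attaches W V) ⇔ T (connected W)
  attaches⇔connected {V} {a} {W} conn a∈V V⊆W = mk⇔ to from
    where
    a∈W : a ∈ W
    a∈W = V⊆W a∈V

    W∪V≡W : W ∪ V ≡ W
    W∪V≡W = ⊆-antisym ([ id , V⊆W ] ∘ x∈p∪q⁻ W V) (p⊆p∪q V)

    V⊆comp : V ⊆ comp W a
    V⊆comp = subst (_⊆ comp W a) (proj₂ (connected⁻ {V} conn) a∈V) (comp-mono V⊆W)

    Attached : Subset N → Set
    Attached X = ∀ {u} → u ∈ X → Nonempty (comp X u ∩ V)

    to : T (attaches W V) → T (connected W)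
    to att = ⊆comp⇒connected a∈W λ {u} u∈W →
      let x , x∈ = subst Attached W∪V≡W (attaches⁻ att) u∈W
          x∈comp , x∈V = x∈p∩q⁻ _ V x∈
      in subst (u ∈_) (trans (sym (comp-≡ u∈W x∈comp)) (comp-≡ a∈W (V⊆comp x∈V))) (a∈comp W u)

    from : T (connected W) → T (attaches W V)
    from connW = attaches⁺ (subst Attached (sym W∪V≡W) λ {u} u∈W →
      a , x∈p∩q⁺ (subst (a ∈_) (sym (proj₂ (connected⁻ {W} connW) u∈W)) a∈W , a∈V))

∈-range⁺ : ∀ {i k} → 1 ≤ i → i ≤ k → i ∈ᴸ map suc (upTo k)
∈-range⁺ {suc i} _ i<k = ∈-map⁺ suc (∈-upTo⁺ i<k)

∈-range⁻ : ∀ {i k} → i ∈ᴸ map suc (upTo k) → 1 ≤ i × i ≤ k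
∈-range⁻ i∈ with _ , j∈ , refl ← ∈-map⁻ suc i∈ = s≤s z≤n , ∈-upTo⁻ j∈

range-unique : ∀ k → Unique (map suc (upTo k))
range-unique k = Unique.map⁺ ℕ.suc-injective (Unique.upTo⁺ k)

module Sums {c ℓ} (R : CommutativeRing c ℓ) where

  open CommutativeRing R renaming (refl to ≈-refl; sym to ≈-sym; trans to ≈-trans)
  open import Relation.Binary.Reasoning.Setoid setoid

  private
    variable
      X Y : Set
      zs : List X
      f g : X → Carrier

  -- The same fold as Cumulants.Σ, which is only available once γ and p are fixed.
  Σ : List X → (X → Carrier) → Carrier
  Σ xs f = foldr (λ x acc → f x + acc) 0# xs

  when : Bool → Carrier → Carrier
  when b x = if b then x else 0#

  when-true : ∀ {b} x → T b → when b x ≈ x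
  when-true {true} x _ = ≈-refl

  when-false : ∀ {b} x → ¬ T b → when b x ≈ 0#
  when-false {true}  x ¬t = ⊥-elim (¬t _)
  when-false {false} x _  = ≈-refl

  when-cong : ∀ b {x y} → x ≈ y → when b x ≈ when b y
  when-cong true  x≈y = x≈y
  when-cong false _   = ≈-refl

  when-∧ : ∀ a b x → when (a ∧ b) x ≈ when a (when b x)
  when-∧ true  b x = ≈-refl
  when-∧ false b x = ≈-refl

  *-when : ∀ a b x → a * when b x ≈ when b (a * x)
  *-when a true  x = ≈-refl
  *-when a false x = zeroʳ a

  Σ-cong : ∀ (zs : List X) → (∀ {x} → x ∈ᴸ zs → f x ≈ g x) → Σ zs f ≈ Σ zs g
  Σ-cong []       h = ≈-refl
  Σ-cong (_ ∷ zs) h = +-cong (h (here refl)) (Σ-cong zs (h ∘ there))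

  Σ-zero : ∀ (zs : List X) → (∀ {x} → x ∈ᴸ zs → f x ≈ 0#) → Σ zs f ≈ 0#
  Σ-zero []       h = ≈-refl
  Σ-zero (_ ∷ zs) h = ≈-trans (+-cong (h (here refl)) (Σ-zero zs (h ∘ there))) (+-identityˡ 0#)

  Σ-filterᵇ : ∀ (p : X → Bool) xs f → Σ (filterᵇ p xs) f ≈ Σ xs (λ x → when (p x) (f x))
  Σ-filterᵇ p []       f = ≈-refl
  Σ-filterᵇ p (x ∷ xs) f with p x
  ... | true  = +-congˡ (Σ-filterᵇ p xs f)
  ... | false = ≈-trans (Σ-filterᵇ p xs f) (≈-sym (+-identityˡ _))

  Σ-+ : ∀ (xs : List X) f g → Σ xs (λ x → f x + g x) ≈ Σ xs f + Σ xs g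
  Σ-+ []       f g = ≈-sym (+-identityˡ 0#)
  Σ-+ (x ∷ xs) f g = begin
    (f x + g x) + Σ xs (λ x → f x + g x) ≈⟨ +-congˡ (Σ-+ xs f g) ⟩
    (f x + g x) + (Σ xs f + Σ xs g)      ≈⟨ +-assoc _ _ _ ⟩
    f x + (g x + (Σ xs f + Σ xs g))      ≈⟨ +-congˡ (x+[y+z]≈y+[x+z] _ _ _) ⟩
    f x + (Σ xs f + (g x + Σ xs g))      ≈⟨ +-assoc _ _ _ ⟨
    (f x + Σ xs f) + (g x + Σ xs g)      ∎
    where
    x+[y+z]≈y+[x+z] : ∀ a b d → a + (b + d) ≈ b + (a + d)
    x+[y+z]≈y+[x+z] a b d = ≈-trans (≈-sym (+-assoc a b d)) (≈-trans (+-congʳ (+-comm a b)) (+-assoc b a d))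

  Σ-swap : ∀ (xs : List X) (ys : List Y) (f : X → Y → Carrier) →
           Σ xs (λ x → Σ ys (f x)) ≈ Σ ys (λ y → Σ xs (λ x → f x y))
  Σ-swap []       ys f = ≈-sym (Σ-zero ys (λ _ → ≈-refl))
  Σ-swap (x ∷ xs) ys f = ≈-trans (+-congˡ (Σ-swap xs ys f)) (≈-sym (Σ-+ ys (f x) _))

  *-Σ : ∀ a (xs : List X) f → a * Σ xs f ≈ Σ xs (λ x → a * f x)
  *-Σ a []       f = zeroʳ a
  *-Σ a (x ∷ xs) f = ≈-trans (distribˡ a (f x) (Σ xs f)) (+-congˡ (*-Σ a xs f))

  when-Σ : ∀ b (xs : List X) f → when b (Σ xs f) ≈ Σ xs (λ x → when b (f x))
  when-Σ true  xs f = ≈-refl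
  when-Σ false xs f = ≈-sym (Σ-zero xs (λ _ → ≈-refl))

  Σ-unique : Unique zs → ∀ {x₀} → x₀ ∈ᴸ zs → (∀ {x} → x ∈ᴸ zs → x ≢ x₀ → f x ≈ 0#) →
             Σ zs f ≈ f x₀
  Σ-unique {zs = _ ∷ zs} (x∉zs ∷ _) (here refl) h = ≈-trans
    (+-congˡ (Σ-zero zs λ x∈ → h (there x∈) λ { refl → All.lookup x∉zs x∈ refl }))
    (+-identityʳ _)
  Σ-unique (x∉zs ∷ uniq) (there x₀∈) h = ≈-trans
    (+-cong (h (here refl) λ { refl → All.lookup x∉zs x₀∈ refl }) (Σ-unique uniq x₀∈ (h ∘ there)))
    (+-identityˡ _)

  Σ-++ : ∀ (xs ys : List X) f → Σ (xs ++ ys) f ≈ Σ xs f + Σ ys f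
  Σ-++ []       ys f = ≈-sym (+-identityˡ _)
  Σ-++ (x ∷ xs) ys f = ≈-trans (+-congˡ (Σ-++ xs ys f)) (≈-sym (+-assoc _ _ _))

  Σ-concatMap : ∀ (h : X → List Y) xs f → Σ (concatMap h xs) f ≈ Σ xs (λ x → Σ (h x) f)
  Σ-concatMap h []       f = ≈-refl
  Σ-concatMap h (x ∷ xs) f = ≈-trans (Σ-++ (h x) (concatMap h xs) f) (+-congˡ (Σ-concatMap h xs f))

  Σ-subsets-single : ∀ {n} (f : Subset n → Carrier) V₀ → (∀ {V} → V ≢ V₀ → f V ≈ 0#) →
                     Σ (subsets n) f ≈ f V₀
  Σ-subsets-single {zero}  f [] h = +-identityʳ _
  Σ-subsets-single {suc n} f (b ∷ V₀) h = begin
    Σ (subsets (suc n)) f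
      ≈⟨ Σ-concatMap _ (subsets n) f ⟩
    Σ (subsets n) (λ V → f (outside ∷ V) + (f (inside ∷ V) + 0#))
      ≈⟨ Σ-subsets-single _ V₀ (λ V≢V₀ → both-zero (V≢V₀ ∘ ∷-injectiveʳ)) ⟩
    f (outside ∷ V₀) + (f (inside ∷ V₀) + 0#)
      ≈⟨ +-congˡ (+-identityʳ _) ⟩
    f (outside ∷ V₀) + f (inside ∷ V₀)
      ≈⟨ only b h ⟩
    f (b ∷ V₀) ∎
    where
    both-zero : ∀ {V} → (∀ {b′} → b′ ∷ V ≢ b ∷ V₀) → f (outside ∷ V) + (f (inside ∷ V) + 0#) ≈ 0#
    both-zero ne = ≈-trans (+-cong (h ne) (≈-trans (+-identityʳ _) (h ne))) (+-identityʳ 0#)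
    only : ∀ b → (∀ {V} → V ≢ b ∷ V₀ → f V ≈ 0#) →
           f (outside ∷ V₀) + f (inside ∷ V₀) ≈ f (b ∷ V₀)
    only true  h = ≈-trans (+-congʳ (h λ ())) (+-identityˡ _)
    only false h = ≈-trans (+-congˡ (h λ ())) (+-identityʳ _)

  Σ-range-δ : ∀ {k n} (f : ℕ → Carrier) → 1 ≤ n → n ≤ k →
              Σ (map suc (upTo k)) (λ i → when (n ≡ᵇ i) (f i)) ≈ f n
  Σ-range-δ {k} {n} f 1≤n n≤k =
    ≈-trans (Σ-unique (range-unique k) (∈-range⁺ 1≤n n≤k) off-diagonal) (when-true _ (≡⇒≡ᵇ n n refl))
    where
    off-diagonal : ∀ {i} → i ∈ᴸ map suc (upTo k) → i ≢ n → when (n ≡ᵇ i) (f i) ≈ 0#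
    off-diagonal _ i≢n = when-false _ (i≢n ∘ sym ∘ ≡ᵇ⇒≡ n _)

  Σ-range-δ-∉ : ∀ {k n} (f : ℕ → Carrier) → ¬ (1 ≤ n × n ≤ k) →
                Σ (map suc (upTo k)) (λ i → when (n ≡ᵇ i) (f i)) ≈ 0#
  Σ-range-δ-∉ {k} {n} f n∉ = Σ-zero (map suc (upTo k)) λ i∈ → when-false _ λ n≡ᵇi →
    n∉ (subst (λ j → 1 ≤ j × j ≤ k) (sym (≡ᵇ⇒≡ n _ n≡ᵇi)) (∈-range⁻ i∈))

  Σ-range-δ-when : ∀ {k n b} x → (T b → ¬ (1 ≤ n × n ≤ k) → x ≈ 0#) →
                   Σ (map suc (upTo k)) (λ i → when ((n ≡ᵇ i) ∧ b) x) ≈ when b x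
  Σ-range-δ-when {k} {n} {b} x h = begin
    Σ (map suc (upTo k)) (λ i → when ((n ≡ᵇ i) ∧ b) x)
      ≈⟨ Σ-cong (map suc (upTo k)) (λ _ → when-∧ _ b x) ⟩
    Σ (map suc (upTo k)) (λ i → when (n ≡ᵇ i) (when b x))
      ≈⟨ collapse ((1 ℕ.≤? n) ×-dec (n ℕ.≤? k)) ⟩
    when b x ∎
    where
    collapse : Dec (1 ≤ n × n ≤ k) → Σ (map suc (upTo k)) (λ i → when (n ≡ᵇ i) (when b x)) ≈ when b x
    collapse (yes (1≤n , n≤k)) = Σ-range-δ (λ _ → when b x) 1≤n n≤k
    collapse (no n∉)           = ≈-trans (Σ-range-δ-∉ (λ _ → when b x) n∉) (≈-sym (vanishes (T? b)))
      where
      vanishes : Dec (T b) → when b x ≈ 0#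
      vanishes (yes t) = ≈-trans (when-true x t) (h t n∉)
      vanishes (no ¬t) = when-false x ¬t

module Expansion {ℓ₁ ℓ₂ : Level} (R : CommutativeRing ℓ₁ ℓ₂) {m N : ℕ}
                 (γ : Fin N → Subset m) (p : Fin m → CommutativeRing.Carrier R) (k : ℕ) where

  open CommutativeRing R renaming (refl to ≈-refl; sym to ≈-sym; trans to ≈-trans)
  open import Relation.Binary.Reasoning.Setoid setoid
  open import Algebra.Properties.Ring ring using (-‿involutive)
  open Sums R hiding (Σ)
  open Cumulants R γ p
  open Graph γ hiding (C)
  open Components γ

  private
    variable
      V W : Subset N
      ℓ ℓ₀ : Fin N

  extends : Subset N → Fin N → Subset N → Bool
  extends V ℓ W = (V ⊆ᵇ W) ∧ (W ⊆ᵇ (V ∪ below ℓ)) ∧ attaches W V ∧ (∣ W ∣ ≤ᵇ k)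

  admissible : Subset N → Fin N → Subset N → Bool
  admissible W ℓ V = (connected V ∧ hasMax V ℓ) ∧ extends V ℓ W

  record Admissible (W : Subset N) (ℓ : Fin N) (V : Subset N) : Set where
    field
      V-connected : T (connected V)
      V-max       : IsMax V ℓ
      V⊆W         : V ⊆ W
      W⊆V∪below   : W ⊆ V ∪ below ℓ
      W→V         : T (attaches W V)
      ∣W∣≤k       : ∣ W ∣ ≤ k

  admissible⁺ : Admissible W ℓ V → T (admissible W ℓ V)
  admissible⁺ adm = ∧⁺ (∧⁺ V-connected (hasMax⁺ V-max))
                       (∧⁺ (⊆ᵇ⁺ V⊆W) (∧⁺ (⊆ᵇ⁺ W⊆V∪below) (∧⁺ W→V (≤⇒≤ᵇ ∣W∣≤k))))
    where open Admissible adm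

  admissible⁻ : T (admissible W ℓ V) → Admissible W ℓ V
  admissible⁻ {W} {ℓ} {V} t = record
    { V-connected = proj₁ (∧⁻ shape)
    ; V-max       = hasMax⁻ (proj₂ (∧⁻ {connected V} shape))
    ; V⊆W         = ⊆ᵇ⁻ (proj₁ (∧⁻ ext))
    ; W⊆V∪below   = ⊆ᵇ⁻ (proj₁ (∧⁻ ext₁))
    ; W→V         = proj₁ (∧⁻ ext₂)
    ; ∣W∣≤k       = ≤ᵇ⇒≤ _ _ (proj₂ (∧⁻ {attaches W V} ext₂))
    }
    where
    shape : T (connected V ∧ hasMax V ℓ)
    shape = proj₁ (∧⁻ {connected V ∧ hasMax V ℓ} t)
    ext : T (extends V ℓ W)
    ext = proj₂ (∧⁻ {connected V ∧ hasMax V ℓ} t)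
    ext₁ : T ((W ⊆ᵇ (V ∪ below ℓ)) ∧ attaches W V ∧ (∣ W ∣ ≤ᵇ k))
    ext₁ = proj₂ (∧⁻ {V ⊆ᵇ W} ext)
    ext₂ : T (attaches W V ∧ (∣ W ∣ ≤ᵇ k))
    ext₂ = proj₂ (∧⁻ {W ⊆ᵇ (V ∪ below ℓ)} ext₁)

  admissible-size : Admissible W ℓ V → 1 ≤ ∣ V ∣ × ∣ V ∣ ≤ k
  admissible-size adm = x∈p⇒0<∣p∣ (proj₁ V-max) , ≤-trans (p⊆q⇒∣p∣≤∣q∣ V⊆W) ∣W∣≤k
    where open Admissible adm

  admissible-root : Admissible W ℓ V → IsMax W ℓ₀ → ℓ ≡ ℓ₀
  admissible-root {W} {ℓ} {V} {ℓ₀} adm (ℓ₀∈W , ≤ℓ₀) =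
    Fin.≤-antisym (≤ℓ₀ (V⊆W (proj₁ V-max))) (ℓ₀≤ℓ (x∈p∪q⁻ V (below ℓ) (W⊆V∪below ℓ₀∈W)))
    where
    open Admissible adm
    ℓ₀≤ℓ : ℓ₀ ∈ V ⊎ ℓ₀ ∈ below ℓ → ℓ₀ Fin.≤ ℓ
    ℓ₀≤ℓ (inj₁ ℓ₀∈V)     = proj₂ V-max ℓ₀∈V
    ℓ₀≤ℓ (inj₂ ℓ₀∈below) = <⇒≤ (below⁻ ℓ₀∈below)

  admissible⇒connected : Admissible W ℓ V → T (connected W)
  admissible⇒connected adm = Equivalence.to (attaches⇔connected V-connected (proj₁ V-max) V⊆W) W→V
    where open Admissible adm

  comp-admissible : T (connected W) → ∣ W ∣ ≤ k → IsMax W ℓ → P ⊆ W → ℓ ∈ P →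
                    Admissible W ℓ (comp P ℓ)
  comp-admissible {W} {ℓ} {P} connW ∣W∣≤k (_ , ≤ℓ) P⊆W ℓ∈P = record
    { V-connected = connected-comp ℓ∈P
    ; V-max       = a∈comp P ℓ , ≤ℓ ∘ comp⊆W
    ; V⊆W         = comp⊆W
    ; W⊆V∪below   = λ {j} j∈W → x∈p∪q⁺ (root-or-below j∈W (j Fin.≟ ℓ))
    ; W→V         = Equivalence.from (attaches⇔connected (connected-comp ℓ∈P) (a∈comp P ℓ) comp⊆W) connW
    ; ∣W∣≤k       = ∣W∣≤k
    }
    where
    comp⊆W : comp P ℓ ⊆ W
    comp⊆W = P⊆W ∘ comp-⊆ ℓ∈P
    root-or-below : ∀ {j} → j ∈ W → Dec (j ≡ ℓ) → j ∈ comp P ℓ ⊎ j ∈ below ℓ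
    root-or-below _   (yes refl) = inj₁ (a∈comp P ℓ)
    root-or-below j∈W (no j≢ℓ)   = inj₂ (below⁺ (Fin.≤∧≢⇒< (≤ℓ j∈W) j≢ℓ))

  goodPartition⁺ : P ∈ᴸ π → V ⊆ P → T (unionOfComponents V P) → T (goodPartition V π)
  goodPartition⁺ {V = V} P∈ V⊆P uoc =
    any⁺ (λ P → (V ⊆ᵇ P) ∧ unionOfComponents V P) (lose P∈ (∧⁺ (⊆ᵇ⁺ V⊆P) uoc))

  goodPartition⁻ : T (goodPartition V π) → ∃ λ P → P ∈ᴸ π × V ⊆ P × T (unionOfComponents V P)
  goodPartition⁻ {V} {π} t with P , P∈ , t′ ← find (any⁻ (λ P → (V ⊆ᵇ P) ∧ unionOfComponents V P) π t) =
    P , P∈ , ⊆ᵇ⁻ (proj₁ (∧⁻ t′)) , proj₂ (∧⁻ {V ⊆ᵇ P} t′)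

  term : Subset N → Subset N → Carrier
  term V W = sgn (∣ W ∣ ∸ 1) * κ[ V ] W

  -- The only admissible V with π ∈ Π^C_V(W) is the component of ℓ₀ in the block of π containing ℓ₀.
  Σ-admissible-good : T (connected W) → ∣ W ∣ ≤ k → IsMax W ℓ₀ → π ∈ᴸ partitions W → ∀ x →
                      Σ (subsets N) (λ V → when (admissible W ℓ₀ V) (when (goodPartition V π) x)) ≈ x
  Σ-admissible-good {W} {ℓ₀} {π} connW ∣W∣≤k max@(ℓ₀∈W , _) π∈ x
    with P₀ , P₀∈ , ℓ₀∈P₀ ← partition-block π∈ ℓ₀∈W = begin
    Σ (subsets N) (λ V → when (admissible W ℓ₀ V) (when (goodPartition V π) x))
      ≈⟨ Σ-subsets-single _ (comp P₀ ℓ₀) vanish ⟩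
    when (admissible W ℓ₀ (comp P₀ ℓ₀)) (when (goodPartition (comp P₀ ℓ₀) π) x)
      ≈⟨ when-true _ (admissible⁺ (comp-admissible connW ∣W∣≤k max (partition-⊆ π∈ P₀∈) ℓ₀∈P₀)) ⟩
    when (goodPartition (comp P₀ ℓ₀) π) x
      ≈⟨ when-true x (goodPartition⁺ P₀∈ (comp-⊆ ℓ₀∈P₀) (unionOfComponents-comp ℓ₀∈P₀)) ⟩
    x ∎
    where
    admissible∧good⇒≡ : ∀ {V} → T (admissible W ℓ₀ V) → T (goodPartition V π) → V ≡ comp P₀ ℓ₀
    admissible∧good⇒≡ {V} t good with Q , Q∈ , V⊆Q , uoc ← goodPartition⁻ {V} {π} good =
      trans (connected∧unionOfComponents⇒≡comp {V} {ℓ₀} {Q} (Admissible.V-connected adm) ℓ₀∈V uoc)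
            (cong (λ X → comp X ℓ₀) (partition-block-≡ {W = W} π∈ Q∈ P₀∈ (V⊆Q ℓ₀∈V) ℓ₀∈P₀))
      where
      adm : Admissible W ℓ₀ V
      adm = admissible⁻ {W} {ℓ₀} {V} t
      ℓ₀∈V : ℓ₀ ∈ V
      ℓ₀∈V = proj₁ (Admissible.V-max adm)
    vanish : ∀ {V} → V ≢ comp P₀ ℓ₀ → when (admissible W ℓ₀ V) (when (goodPartition V π) x) ≈ 0#
    vanish {V} V≢ = ≈-trans (≈-sym (when-∧ (admissible W ℓ₀ V) (goodPartition V π) x))
                            (when-false x λ t → V≢ (uncurry admissible∧good⇒≡ (∧⁻ {admissible W ℓ₀ V} t)))

  lhsAt : Subset N → Carrier
  lhsAt W = Σ (allFin N) λ ℓ → Σ (subsets N) λ V → when (admissible W ℓ V) (term V W)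

  rhsAt : Subset N → Carrier
  rhsAt W = Σ (range k) λ i → sgn (suc i) * when ((∣ W ∣ ≡ᵇ i) ∧ connected W) (κ W)

  lhsAt-root : IsMax W ℓ₀ → lhsAt W ≈ Σ (subsets N) (λ V → when (admissible W ℓ₀ V) (term V W))
  lhsAt-root {W} max = Σ-unique (Unique.allFin⁺ N) (∈-allFin _) λ {ℓ} _ ℓ≢ℓ₀ →
    Σ-zero (subsets N) λ {V} _ → when-false _ λ t → ℓ≢ℓ₀ (admissible-root (admissible⁻ {W} {ℓ} {V} t) max)

  lhsAt-good : T (connected W) → ∣ W ∣ ≤ k → lhsAt W ≈ sgn (∣ W ∣ ∸ 1) * κ W
  lhsAt-good {W} connW ∣W∣≤k with top , top-max ← max-exists (proj₁ (connected⁻ {W} connW)) = begin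
    lhsAt W
      ≈⟨ lhsAt-root top-max ⟩
    Σ (subsets N) (λ V → when (admissible W top V) (s * Σ (filterᵇ (goodPartition V) (partitions W)) cμ))
      ≈⟨ Σ-cong (subsets N) (λ {V} _ → pull-out V) ⟩
    Σ (subsets N) (λ V → s * Σ (partitions W) (λ π → good-term V π))
      ≈⟨ *-Σ s (subsets N) _ ⟨
    s * Σ (subsets N) (λ V → Σ (partitions W) (λ π → good-term V π))
      ≈⟨ *-congˡ (Σ-swap (subsets N) (partitions W) _) ⟩
    s * Σ (partitions W) (λ π → Σ (subsets N) (λ V → good-term V π))
      ≈⟨ *-congˡ (Σ-cong (partitions W) λ {π} π∈ → Σ-admissible-good connW ∣W∣≤k top-max π∈ (cμ π)) ⟩
    s * κ W ∎
    where
    s : Carrier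
    s = sgn (∣ W ∣ ∸ 1)
    cμ : List (Subset N) → Carrier
    cμ π = coef π * μ π
    good-term : Subset N → List (Subset N) → Carrier
    good-term V π = when (admissible W top V) (when (goodPartition V π) (cμ π))
    pull-out : ∀ V → when (admissible W top V) (s * Σ (filterᵇ (goodPartition V) (partitions W)) cμ)
                   ≈ s * Σ (partitions W) (good-term V)
    pull-out V = begin
      when a (s * Σ (filterᵇ (goodPartition V) (partitions W)) cμ)
        ≈⟨ when-cong a (*-congˡ (Σ-filterᵇ _ (partitions W) cμ)) ⟩
      when a (s * Σ (partitions W) (λ π → when (goodPartition V π) (cμ π)))
        ≈⟨ *-when s a _ ⟨
      s * when a (Σ (partitions W) (λ π → when (goodPartition V π) (cμ π)))
        ≈⟨ *-congˡ (when-Σ a (partitions W) _) ⟩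
      s * Σ (partitions W) (good-term V) ∎
      where
      a : Bool
      a = admissible W top V

  rhsAt-good : T (connected W) → ∣ W ∣ ≤ k → rhsAt W ≈ sgn (suc ∣ W ∣) * κ W
  rhsAt-good {W} connW ∣W∣≤k = begin
    rhsAt W
      ≈⟨ Σ-cong (range k) (λ _ → δ-form _) ⟩
    Σ (range k) (λ i → when (∣ W ∣ ≡ᵇ i) (sgn (suc i) * κ W))
      ≈⟨ Σ-range-δ (λ i → sgn (suc i) * κ W) (connected⇒0<∣W∣ {W} connW) ∣W∣≤k ⟩
    sgn (suc ∣ W ∣) * κ W ∎
    where
    δ-form : ∀ i → sgn (suc i) * when ((∣ W ∣ ≡ᵇ i) ∧ connected W) (κ W)
                   ≈ when (∣ W ∣ ≡ᵇ i) (sgn (suc i) * κ W)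
    δ-form i = begin
      sgn (suc i) * when ((∣ W ∣ ≡ᵇ i) ∧ connected W) (κ W)
        ≈⟨ *-when (sgn (suc i)) _ (κ W) ⟩
      when ((∣ W ∣ ≡ᵇ i) ∧ connected W) (sgn (suc i) * κ W)
        ≈⟨ when-∧ (∣ W ∣ ≡ᵇ i) (connected W) _ ⟩
      when (∣ W ∣ ≡ᵇ i) (when (connected W) (sgn (suc i) * κ W))
        ≈⟨ when-cong (∣ W ∣ ≡ᵇ i) (when-true _ connW) ⟩
      when (∣ W ∣ ≡ᵇ i) (sgn (suc i) * κ W) ∎

  lhsAt-bad : ¬ (T (connected W) × ∣ W ∣ ≤ k) → lhsAt W ≈ 0#
  lhsAt-bad {W} bad = Σ-zero (allFin N) λ {ℓ} _ → Σ-zero (subsets N) λ {V} _ → when-false _ λ t →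
    let adm = admissible⁻ {W} {ℓ} {V} t in bad (admissible⇒connected adm , Admissible.∣W∣≤k adm)

  rhsAt-bad : ¬ (T (connected W) × ∣ W ∣ ≤ k) → rhsAt W ≈ 0#
  rhsAt-bad {W} bad = Σ-zero (range k) λ {i} i∈ → ≈-trans (*-when _ _ _) (when-false _ λ t →
    let ∣W∣≡ᵇi , connW = ∧⁻ {∣ W ∣ ≡ᵇ i} t
    in bad (connW , subst (_≤ k) (sym (≡ᵇ⇒≡ _ _ ∣W∣≡ᵇi)) (proj₂ (∈-range⁻ i∈))))

  sgn-pred≈sgn-suc : ∀ {n} → 0 < n → sgn (n ∸ 1) ≈ sgn (suc n)
  sgn-pred≈sgn-suc {suc n} _ = ≈-sym (-‿involutive (sgn n))

  lhsAt≈rhsAt : ∀ W → lhsAt W ≈ rhsAt W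
  lhsAt≈rhsAt W with T? (connected W) ×-dec (∣ W ∣ ℕ.≤? k)
  ... | no bad = ≈-trans (lhsAt-bad {W} bad) (≈-sym (rhsAt-bad {W} bad))
  ... | yes (connW , ∣W∣≤k) = begin
    lhsAt W                ≈⟨ lhsAt-good {W} connW ∣W∣≤k ⟩
    sgn (∣ W ∣ ∸ 1) * κ W  ≈⟨ *-congʳ (sgn-pred≈sgn-suc (connected⇒0<∣W∣ {W} connW)) ⟩
    sgn (suc ∣ W ∣) * κ W  ≈⟨ rhsAt-good {W} connW ∣W∣≤k ⟨
    rhsAt W                ∎

  Σ-sizes : ∀ ℓ V W →
            Σ (range k) (λ i → when ((∣ V ∣ ≡ᵇ i) ∧ connected V ∧ hasMax V ℓ) (when (extends V ℓ W) (term V W)))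
            ≈ when (admissible W ℓ V) (term V W)
  Σ-sizes ℓ V W =
    ≈-trans (Σ-range-δ-when _ out-of-range) (≈-sym (when-∧ (connected V ∧ hasMax V ℓ) (extends V ℓ W) _))
    where
    out-of-range : T (connected V ∧ hasMax V ℓ) → ¬ (1 ≤ ∣ V ∣ × ∣ V ∣ ≤ k) →
                   when (extends V ℓ W) (term V W) ≈ 0#
    out-of-range shape ∉ = when-false _ λ ext → ∉ (admissible-size (admissible⁻ {W} {ℓ} {V} (∧⁺ shape ext)))

  LHS-by-W : LHS k ≈ Σ (subsets N) lhsAt
  LHS-by-W = begin
    LHS k
      ≈⟨ Σ-cong (allFin N) (λ {ℓ} _ → Σ-cong (range k) λ {i} _ → unfold i ℓ) ⟩
    (Σ (allFin N) λ ℓ → Σ (range k) λ i → Σ (subsets N) λ V → Σ (subsets N) λ W → summand ℓ i V W)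
      ≈⟨ Σ-cong (allFin N) (λ {ℓ} _ → Σ-swap (range k) (subsets N) _) ⟩
    (Σ (allFin N) λ ℓ → Σ (subsets N) λ V → Σ (range k) λ i → Σ (subsets N) λ W → summand ℓ i V W)
      ≈⟨ Σ-cong (allFin N) (λ {ℓ} _ → Σ-cong (subsets N) λ {V} _ → Σ-swap (range k) (subsets N) _) ⟩
    (Σ (allFin N) λ ℓ → Σ (subsets N) λ V → Σ (subsets N) λ W → Σ (range k) λ i → summand ℓ i V W)
      ≈⟨ Σ-cong (allFin N) (λ {ℓ} _ → Σ-cong (subsets N) λ {V} _ → Σ-cong (subsets N) λ {W} _ → Σ-sizes ℓ V W) ⟩
    (Σ (allFin N) λ ℓ → Σ (subsets N) λ V → Σ (subsets N) λ W → when (admissible W ℓ V) (term V W))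
      ≈⟨ Σ-cong (allFin N) (λ {ℓ} _ → Σ-swap (subsets N) (subsets N) _) ⟩
    (Σ (allFin N) λ ℓ → Σ (subsets N) λ W → Σ (subsets N) λ V → when (admissible W ℓ V) (term V W))
      ≈⟨ Σ-swap (allFin N) (subsets N) _ ⟩
    Σ (subsets N) lhsAt ∎
    where
    summand : Fin N → ℕ → Subset N → Subset N → Carrier
    summand ℓ i V W = when ((∣ V ∣ ≡ᵇ i) ∧ connected V ∧ hasMax V ℓ) (when (extends V ℓ W) (term V W))
    unfold : ∀ i ℓ → Σ (Cℓ i ℓ) (λ V → κ⁽ k ⁾[ V ] (below ℓ))
                     ≈ Σ (subsets N) (λ V → Σ (subsets N) (summand ℓ i V))
    unfold i ℓ = ≈-trans (Σ-filterᵇ _ (subsets N) _) (Σ-cong (subsets N) λ {V} _ →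
      ≈-trans (when-cong _ (Σ-filterᵇ (extends V ℓ) (subsets N) (term V))) (when-Σ _ (subsets N) _))

  RHS-by-W : RHS k ≈ Σ (subsets N) rhsAt
  RHS-by-W = begin
    RHS k
      ≈⟨ Σ-cong (range k) (λ {i} _ → ≈-trans (*-congˡ (Σ-filterᵇ _ (subsets N) κ)) (*-Σ _ (subsets N) _)) ⟩
    (Σ (range k) λ i → Σ (subsets N) λ W → sgn (suc i) * when ((∣ W ∣ ≡ᵇ i) ∧ connected W) (κ W))
      ≈⟨ Σ-swap (range k) (subsets N) _ ⟩
    Σ (subsets N) rhsAt ∎

lemma3p5 : ∀ {c ℓ : Level} (R : CommutativeRing c ℓ) (m N : ℕ)
    (γ : Fin N → Subset m) → Injective _≡_ _≡_ γ →
    (p : Fin m → CommutativeRing.Carrier R) (k : ℕ) →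
    CommutativeRing._≈_ R (Cumulants.LHS R γ p k) (Cumulants.RHS R γ p k)
lemma3p5 R m N γ _ p k = begin
  LHS k                ≈⟨ LHS-by-W ⟩
  Σ (subsets N) lhsAt  ≈⟨ Σ-cong (subsets N) (λ {W} _ → lhsAt≈rhsAt W) ⟩
  Σ (subsets N) rhsAt  ≈⟨ RHS-by-W ⟨
  RHS k                ∎
  where
  open CommutativeRing R using (setoid)
  open import Relation.Binary.Reasoning.Setoid setoid
  open Sums R using (Σ-cong)
  open Cumulants R γ p using (Σ; LHS; RHS)
  open Expansion R γ p k using (LHS-by-W; RHS-by-W; lhsAt; rhsAt; lhsAt≈rhsAt)
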